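{- Let $\mathcal{M}=\langle W,S,V\rangle$ and $\mathcal{M}'=\langle W',S',V'\rangle$ be models, $w\in W$, $w'\in W'$. If $(\mathcal{M},w)$ and $(\mathcal{M}',w')$ are $O$-bisimilar, then for every formula $A$ of $\mathcal{L}_O$, $\mathcal{M},w\vDash A$ iff $\mathcal{M}',w'\vDash A$.
   Context: The language $\mathcal{L}_O$ is $A::=p\mid\neg A\mid A\land A\mid OA$. A model is $\langle W,S,V\rangle$ with $W$ nonempty, $S\subseteq W^3$ an arbitrary ternary relation (written $S_wuv$), $V$ a valuation of proposition symbols. $\mathcal{M},w\vDash OA$ iff for all $u,v\in W$ with $S_wuv$, ($\mathcal{M},u\vDash A\iff\mathcal{M},v\vDash A$); other clauses as usual. A nonempty relation $\mathcal{R}\subseteq W\times W'$ is an $O$-bisimulation between $\mathcal{M}$ and $\mathcal{M}'$ if whenever $w\mathcal{R}w'$: (Atom) $w$ and $w'$ satisfy the same proposition symbols; ($O$-Zig) for all $u,v,x\in W$ with $S_wuv$ and $S_wux$, there exist $u',v',x'\in W'$ with $S'_{w'}u'v'$ and $S'_{w'}u'x'$, and there are $y',z_1',z_2'\in\{u',v',x'\}$ with $u\mathcal{R}y'$, $v\mathcal{R}z_1'$, $x\mathcal{R}z_2'$; ($O$-Zag) for all $u',v',x'\in W'$ with $S'_{w'}u'v'$ and $S'_{w'}u'x'$, there exist $u,v,x\in W$ with $S_wuv$ and $S_wux$, and there are $y,z_1,z_2\in\{u,v,x\}$ with $y\mathcal{R}u'$, $z_1\mathcal{R}v'$, $z_2\mathcal{R}x'$.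 $(\mathcal{M},w)$ and $(\mathcal{M}',w')$ are $O$-bisimilar if some $O$-bisimulation contains $(w,w')$. -}

module Defs where

open import Data.Nat using (ℕ)
open import Data.Product using (Σ; ∃; _×_; _,_)
open import Data.Sum using (_⊎_)
open import Relation.Nullary using (¬_)
open import Relation.Binary.PropositionalEquality using (_≡_)
open import Function.Bundles using (_⇔_)
open import Level using (Level; suc; _⊔_)

data Form : Set where
  var  : ℕ → Form
  neg  : Form → Form
  conj : Form → Form → Form
  O    : Form → Form

record Model : Set₁ where
  field
    W        : Set
    inhabited : W
    S        : W → W → W → Set      -- S w u v  is  S_w u v
    V        : ℕ → W → Set

open Model public

_,_⊨_ : (M : Model) → W M → Form → Set
M , w ⊨ var p    = V M p w
M , w ⊨ neg A    = ¬ (M , w ⊨ A)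
M , w ⊨ conj A B = (M , w ⊨ A) × (M , w ⊨ B)
M , w ⊨ O A      = ∀ u v → S M w u v → ((M , u ⊨ A) ⇔ (M , v ⊨ A))

_∈₃_ : {X : Set} → X → X × X × X → Set
y ∈₃ (a , b , c) = (y ≡ a) ⊎ (y ≡ b) ⊎ (y ≡ c)

record IsOBisim (M M' : Model) (R : W M → W M' → Set) : Set where
  field
    nonempty : Σ (W M) λ w → Σ (W M') λ w' → R w w'
    atom : ∀ {w w'} → R w w' → ∀ p → (V M p w → V M' p w') × (V M' p w' → V M p w)
    zig  : ∀ {w w'} → R w w' → ∀ u v x → S M w u v → S M w u x →
           Σ (W M') λ u' → Σ (W M') λ v' → Σ (W M') λ x' →
             S M' w' u' v' × S M' w' u' x' ×
             Σ (W M') λ y' → Σ (W M') λ z₁' → Σ (W M') λ z₂' →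
               (y' ∈₃ (u' , v' , x')) × (z₁' ∈₃ (u' , v' , x')) × (z₂' ∈₃ (u' , v' , x')) ×
               R u y' × R v z₁' × R x z₂'
    zag  : ∀ {w w'} → R w w' → ∀ u' v' x' → S M' w' u' v' → S M' w' u' x' →
           Σ (W M) λ u → Σ (W M) λ v → Σ (W M) λ x →
             S M w u v × S M w u x ×
             Σ (W M) λ y → Σ (W M) λ z₁ → Σ (W M) λ z₂ →
               (y ∈₃ (u , v , x)) × (z₁ ∈₃ (u , v , x)) × (z₂ ∈₃ (u , v , x)) ×
               R y u' × R z₁ v' × R z₂ x'

OBisimilar : (M : Model) → W M → (M' : Model) → W M' → Set₁
OBisimilar M w M' w' =
  Σ (W M → W M' → Set) λ R → IsOBisim M M' R × R w w'

module Submission where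

-- For O A the key observation is that a "fan" at w, i.e. three
-- worlds u, v, x with S_w u v and S_w u x, is A-homogeneous whenever
-- M, w ⊨ O A: every member of {u, v, x} agrees with u on A ('fan-agree').
-- Hence if every S'-edge (u', v') at w' is matched by a fan at w with
-- members y, z agreeing on A with u', v' respectively, then M', w' ⊨ O A
-- ('O-transfer').  The O-Zag clause together with the induction hypothesis
-- supplies exactly such a matching for the forward direction, and the O-Zig
-- clause does so for the backward direction (with the roles of the two
-- models swapped).

open import Defs
open import Function.Bundles using (_⇔_; mk⇔)
open import Function.Properties.Equivalence using (⇔-setoid)
open import Function.Related.TypeIsomorphisms using (¬-cong-⇔)
open import Level using (0ℓ)
open import Relation.Binary.Bundles using (Setoid)
open import Data.Product using (Σ; _×_; _,_)
open import Data.Product.Function.NonDependent.Propositional using (_×-⇔_)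
open import Data.Sum using (inj₁; inj₂)
open import Relation.Binary.PropositionalEquality using (refl)

open Setoid (⇔-setoid 0ℓ) using () renaming (refl to ⇔-refl; sym to ⇔-sym)
open import Relation.Binary.Reasoning.Setoid (⇔-setoid 0ℓ)

fan-agree : (M : Model) (w : W M) (A : Form) → M , w ⊨ O A →
            ∀ {u v x y} → S M w u v → S M w u x → y ∈₃ (u , v , x) →
            (M , y ⊨ A) ⇔ (M , u ⊨ A)
fan-agree M w A hO s₁ s₂ (inj₁ refl)        = ⇔-refl
fan-agree M w A hO s₁ s₂ (inj₂ (inj₁ refl)) = ⇔-sym (hO _ _ s₁)
fan-agree M w A hO s₁ s₂ (inj₂ (inj₂ refl)) = ⇔-sym (hO _ _ s₂)

-- An S'-edge (u', v') at w' is A-matched by a fan at w when there is a fan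
-- {u, v, x} at w containing worlds y, z that agree on A with u', v'.
FanMatch : (M : Model) (w : W M) (M' : Model) (A : Form) → W M' → W M' → Set
FanMatch M w M' A u' v' =
  Σ (W M) λ u → Σ (W M) λ v → Σ (W M) λ x → S M w u v × S M w u x ×
  Σ (W M) λ y → Σ (W M) λ z → y ∈₃ (u , v , x) × z ∈₃ (u , v , x) ×
  ((M , y ⊨ A) ⇔ (M' , u' ⊨ A)) × ((M , z ⊨ A) ⇔ (M' , v' ⊨ A))

-- O A transfers from w to w' as soon as every S'-edge at w' is A-matched by
-- a fan at w: both ends of the edge then agree with the apex of that fan.
O-transfer : (M : Model) (w : W M) (M' : Model) (w' : W M') (A : Form) →
             (∀ u' v' → S M' w' u' v' → FanMatch M w M' A u' v') →
             M , w ⊨ O A → M' , w' ⊨ O A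
O-transfer M w M' w' A match hO u' v' s'
  with match u' v' s'
... | u , v , x , s₁ , s₂ , y , z , y∈ , z∈ , y≈u' , z≈v' = begin
  M' , u' ⊨ A  ≈⟨ ⇔-sym y≈u' ⟩
  M  , y  ⊨ A  ≈⟨ fan-agree M w A hO s₁ s₂ y∈ ⟩
  M  , u  ⊨ A  ≈⟨ ⇔-sym (fan-agree M w A hO s₁ s₂ z∈) ⟩
  M  , z  ⊨ A  ≈⟨ z≈v' ⟩
  M' , v' ⊨ A  ∎

module _ {M M' : Model} {R : W M → W M' → Set} (bisim : IsOBisim M M' R) where
  open IsOBisim bisim

  bisim-invariant : ∀ A {w w'} → R w w' → (M , w ⊨ A) ⇔ (M' , w' ⊨ A)

  -- O-Zag (resp. O-Zig) with v' = x' (resp. v = x) and the induction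
  -- hypothesis turn each edge on one side into a fan match on the other.
  zag-match : ∀ A {w w'} → R w w' → ∀ u' v' → S M' w' u' v' → FanMatch M w M' A u' v'
  zag-match A r u' v' s' with zag r u' v' v' s' s'
  ... | u , v , x , s₁ , s₂ , y , z , _ , y∈ , z∈ , _ , yRu' , zRv' , _ =
    u , v , x , s₁ , s₂ , y , z , y∈ , z∈ ,
    bisim-invariant A yRu' , bisim-invariant A zRv'

  zig-match : ∀ A {w w'} → R w w' → ∀ u v → S M w u v → FanMatch M' w' M A u v
  zig-match A r u v s with zig r u v v s s
  ... | u' , v' , x' , s₁ , s₂ , y' , z' , _ , y∈ , z∈ , _ , uRy' , vRz' , _ =
    u' , v' , x' , s₁ , s₂ , y' , z' , y∈ , z∈ ,
    ⇔-sym (bisim-invariant A uRy') , ⇔-sym (bisim-invariant A vRz')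

  bisim-invariant (var p)    r = let (there , back) = atom r p in mk⇔ there back
  bisim-invariant (neg A)    r = ¬-cong-⇔ (bisim-invariant A r)
  bisim-invariant (conj A B) r = bisim-invariant A r ×-⇔ bisim-invariant B r
  bisim-invariant (O A) {w} {w'} r =
    mk⇔ (O-transfer M w M' w' A (zag-match A r))
        (O-transfer M' w' M w A (zig-match A r))

proposition4p3 : (M M' : Model) (w : W M) (w' : W M') →
    OBisimilar M w M' w' → (A : Form) → (M , w ⊨ A) ⇔ (M' , w' ⊨ A)
proposition4p3 M M' w w' (R , bisim , wRw') A = bisim-invariant bisim A wRw'
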